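{- Let $G$ be a finite bipartite graph on $\Sigma_1=\{0,\dots,N-1\}$ with nonempty bipartition classes $V_1,V_2$, let $G_n$ be as in the context, and let $\underline x\ne\underline y$ be vertices of $G_n$ in the same connected component. Let $r$ (resp. $q$) be the number of blocks of $\tilde{\underline x}$ (resp. $\tilde{\underline y}$) as defined in the context. Then the length of a shortest path between $\underline x$ and $\underline y$ in $G_n$ is at least $r+q-1$ and at most $r+q+\mathrm{Diam}(G)-2$.
   Context: Edge set $E(G)$; each edge joins $V_1$ to $V_2$. $\mathrm{typ}(x)=i$ if $x\in V_i$; for a word over $\Sigma_1$, its type is $i$ if all letters lie in $V_i$, else $0$. For distinct $\underline x,\underline y\in\Sigma_n=\Sigma_1^n$ let $k=|\underline x\wedge\underline y|$ be the length of their longest common prefix and $\tilde{\underline x},\tilde{\underline y}\in\Sigma_{n-k}$ the postfixes with $\underline x=(\underline x\wedge\underline y)\tilde{\underline x}$, $\underline y=(\underline x\wedge\underline y)\tilde{\underline y}$. $G_n$ is the graph on $\Sigma_n$ with a loop at every vertex and distinct $\underline x,\underline y$ adjacent iff $\{\mathrm{typ}(\tilde{\underline x}),\mathrm{typ}(\tilde{\underline y})\}=\{1,2\}$ and $\{x_i,y_i\}\in E(G)$ for all $k<i\le n$. Decompose $\tilde{\underline x}=\underline b_1\cdots\underline b_r$ and $\tilde{\underline y}=\underline c_1\cdots\underline c_q$ into blocks (nonempty subwords) each of nonzero type such that consecutive blocks have different types (i.e. maximal runs of letters lying in the same $V_i$). $\mathrm{Diam}(G)$ is the maximal graph distance in $G$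 between two vertices in the same connected component of $G$. -}

module Defs where

open import Data.Nat using (ℕ; zero; suc; _+_; _≤_)
open import Data.Bool using (Bool; true; false; if_then_else_)
open import Data.Fin using (Fin)
open import Data.Fin.Properties using (_≟_)
open import Data.Vec using (Vec; []; _∷_)
open import Data.Product using (Σ; ∃; _×_; _,_)
open import Data.Sum using (_⊎_)
open import Relation.Nullary using (¬_; yes; no)
open import Relation.Binary.PropositionalEquality using (_≡_; _≢_)

data Walk {A : Set} (R : A → A → Set) : A → A → ℕ → Set where
  here : ∀ {x} → Walk R x x 0
  step : ∀ {x y z k} → R x y → Walk R y z k → Walk R x z (suc k)

Connected : {A : Set} → (A → A → Set) → A → A → Set
Connected R x y = ∃ λ k → Walk R x y k

IsDist : {A : Set} → (A → A → Set) → A → A → ℕ → Set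
IsDist R x y d = Walk R x y d × (∀ k → Walk R x y k → d ≤ k)

IsDiam : {A : Set} → (A → A → Set) → ℕ → Set
IsDiam {A} R D =
  (∀ (u v : A) d → IsDist R u v d → d ≤ D) × (∃ λ u → ∃ λ v → IsDist R u v D)

-- Bipartite graph G on Σ₁ = Fin N with classes
--   V₁ = { a | side a ≡ true },  V₂ = { a | side a ≡ false }.

record IsBipartiteGraph {N : ℕ} (E : Fin N → Fin N → Set) (side : Fin N → Bool) : Set where
  field
    symmetric : ∀ a b → E a b → E b a
    crossing  : ∀ a b → E a b → side a ≢ side b
    V₁-nonempty : ∃ λ a → side a ≡ true
    V₂-nonempty : ∃ λ a → side a ≡ false

allSide : {N m : ℕ} → (Fin N → Bool) → Bool → Vec (Fin N) m → Bool
allSide side b [] = true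
allSide side b (a ∷ w) with side a | b
... | true  | true  = allSide side b w
... | false | false = allSide side b w
... | _     | _     = false

-- typ(w) = 1 if all letters in V₁, 2 if all in V₂, 0 otherwise
-- (only ever applied to nonempty words).
typ : {N m : ℕ} → (Fin N → Bool) → Vec (Fin N) m → ℕ
typ side w = if allSide side true w then 1
             else (if allSide side false w then 2 else 0)

-- Postfixes after the longest common prefix: (x̃ , ỹ) of common length n - k.
postfixes : {N n : ℕ} → Vec (Fin N) n → Vec (Fin N) n →
            Σ ℕ λ m → Vec (Fin N) m × Vec (Fin N) m
postfixes [] [] = 0 , [] , []
postfixes {n = suc n} (a ∷ x) (b ∷ y) with a ≟ b
... | yes _ = postfixes x y
... | no  _ = suc n , a ∷ x , b ∷ y

data PointwiseE {N : ℕ} (E : Fin N → Fin N → Set) :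
     {m : ℕ} → Vec (Fin N) m → Vec (Fin N) m → Set where
  []  : PointwiseE E [] []
  _∷_ : ∀ {m a b} {x y : Vec (Fin N) m} →
        E a b → PointwiseE E x y → PointwiseE E (a ∷ x) (b ∷ y)

PostfixAdj : {N m : ℕ} → (Fin N → Fin N → Set) → (Fin N → Bool) →
             Vec (Fin N) m → Vec (Fin N) m → Set
PostfixAdj E side x̃ ỹ =
  ((typ side x̃ ≡ 1 × typ side ỹ ≡ 2) ⊎ (typ side x̃ ≡ 2 × typ side ỹ ≡ 1))
  × PointwiseE E x̃ ỹ

Gn : {N : ℕ} → (Fin N → Fin N → Set) → (Fin N → Bool) → (n : ℕ) →
     Vec (Fin N) n → Vec (Fin N) n → Set
Gn E side n x y = x ≡ y ⊎ (x ≢ y × PostfixAdj' (postfixes x y))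
  where
    PostfixAdj' : Σ ℕ (λ m → Vec (Fin _) m × Vec (Fin _) m) → Set
    PostfixAdj' (m , x̃ , ỹ) = PostfixAdj E side x̃ ỹ

-- Number of blocks = number of maximal runs of letters in the same class.
-- Boolean equality of classes.
sameSide : Bool → Bool → Bool
sameSide true  true  = true
sameSide false false = true
sameSide _     _     = false

-- changes side c w : number of class changes along the word, where c is the
-- class of the preceding letter.
changes : {N m : ℕ} → (Fin N → Bool) → Bool → Vec (Fin N) m → ℕ
changes side c [] = 0
changes side c (b ∷ w) =
  (if sameSide c (side b) then 0 else 1) + changes side (side b) w

blocks : {N m : ℕ} → (Fin N → Bool) → Vec (Fin N) m → ℕ
blocks side [] = 0
blocks side (a ∷ w) = suc (changes side (side a) w)

blocksˣ : {N n : ℕ} → (Fin N → Bool) → Vec (Fin N) n → Vec (Fin N) n → ℕ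
blocksˣ side x y with postfixes x y
... | _ , x̃ , _ = blocks side x̃

blocksʸ : {N n : ℕ} → (Fin N → Bool) → Vec (Fin N) n → Vec (Fin N) n → ℕ
blocksʸ side x y with postfixes x y
... | _ , _ , ỹ = blocks side ỹ

module Submission where

-- 1. Adjacency in G_n is recast as an inductive relation 'Step': a step either
--    keeps the first letter and steps in the tail, or replaces a whole
--    monochromatic word by a letterwise G-adjacent one.
-- 2. Lower bound: r + q - 1 (with r + q computed by 'blockSum') drops by at
--    most one along a step, so every walk from x to y has length ≥ r + q - 1.
-- 3. Upper bound: behind the common prefix, x̃ = a·u can be made monochromatic
--    in at most r - 1 steps by flipping its blocks from the back, and likewise
--    ỹ in q - 1 steps.  Two monochromatic words whose letters are pointwise
--    connected in G are then joined in at most Diam(G) steps: each letterwise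
--    G-walk is shortened to length ≤ D, padded (back and forth along an edge)
--    to a common length of the right parity, and the padded walks are
--    traversed simultaneously.  Shortest G-walks exist only classically, so
--    this part is proved under double negation, which the decidable goal
--    d ≤ r + q + D - 2 finally removes.

open import Defs
open import Data.Nat using (ℕ; zero; suc; _+_; _∸_; _≤_; _<_; z≤n; s≤s; _≤?_)
open import Data.Nat.Properties
  using (≤-refl; ≤-trans; ≤-reflexive; ≤-pred; n≤1+n; m≤n+m; ≮⇒≥; +-suc; +-comm; +-assoc;
         +-mono-≤; +-monoʳ-≤; +-monoˡ-≤; m∸n+n≡m; m∸n≤m; m≤n⇒m<n∨m≡n)
open import Data.Nat.Induction using (<-rec)
open import Data.Bool using (Bool; true; false; not; _xor_)
open import Data.Bool.Properties using (¬-not; not-distribˡ-xor)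
import Data.Bool.Properties as Bool
open import Data.Fin using (Fin)
open import Data.Fin.Properties using (_≟_)
open import Data.Vec using (Vec; []; _∷_)
open import Data.Vec.Relation.Unary.All using (All; []; _∷_)
open import Data.Vec.Relation.Binary.Pointwise.Inductive as Pointwise
  using (Pointwise; []; _∷_)
open import Data.Product using (Σ; ∃; _×_; _,_; proj₁; proj₂)
open import Data.Sum using (_⊎_; inj₁; inj₂)
open import Function using (_∘_; id)
open import Relation.Nullary using (¬_; yes; no)
open import Relation.Nullary.Negation using (¬¬-map; contradiction)
open import Relation.Nullary.Decidable using (decidable-stable; ¬¬-excluded-middle)
open import Relation.Binary.PropositionalEquality
  using (_≡_; _≢_; refl; sym; trans; cong; cong₂; subst; module ≡-Reasoning)

module _ {A : Set} where

  infixr 5 _++ᵂ_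
  infixl 5 _∷ʳᵂ_

  _++ᵂ_ : {R : A → A → Set} {x y z : A} {k l : ℕ} →
          Walk R x y k → Walk R y z l → Walk R x z (k + l)
  here       ++ᵂ w = w
  step r v   ++ᵂ w = step r (v ++ᵂ w)

  _∷ʳᵂ_ : {R : A → A → Set} {x y z : A} {k : ℕ} →
          Walk R x y k → R y z → Walk R x z (suc k)
  here       ∷ʳᵂ r = step r here
  step r′ v  ∷ʳᵂ r = step r′ (v ∷ʳᵂ r)

  reverseᵂ : {R : A → A → Set} → (∀ {x y} → R x y → R y x) →
             {x y : A} {k : ℕ} → Walk R x y k → Walk R y x k
  reverseᵂ sym-R here       = here
  reverseᵂ sym-R (step r v) = reverseᵂ sym-R v ∷ʳᵂ sym-R r

mapᵂ : {A B : Set} {R : A → A → Set} {S : B → B → Set} (f : A → B) →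
       (∀ {x y} → R x y → S (f x) (f y)) →
       {x y : A} {k : ℕ} → Walk R x y k → Walk S (f x) (f y) k
mapᵂ f g here       = here
mapᵂ f g (step r v) = step (g r) (mapᵂ f g v)

¬¬-least : {P : ℕ → Set} {k : ℕ} → P k →
           ¬ ¬ (∃ λ m → P m × (∀ j → P j → m ≤ j))
¬¬-least {P} {k} = <-rec (λ k → P k → ¬ ¬ Least) search k
  where
    Least : Set
    Least = ∃ λ m → P m × (∀ j → P j → m ≤ j)

    search : ∀ k → (∀ {j} → j < k → P j → ¬ ¬ Least) → P k → ¬ ¬ Least
    search k smaller pk noLeast =
      ¬¬-excluded-middle {A = ∃ λ j → j < k × P j} λ where
        (yes (j , j<k , pj)) → smaller j<k pj noLeast
        (no none)            → noLeast (k , pk , λ j pj → ≮⇒≥ (λ j<k → none (j , j<k , pj)))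

odd : ℕ → Bool
odd zero    = false
odd (suc n) = not (odd n)

odd-+ : ∀ m n → odd (m + n) ≡ odd m xor odd n
odd-+ zero    n = refl
odd-+ (suc m) n = trans (cong not (odd-+ m n)) (not-distribˡ-xor (odd m) (odd n))

xor-cancelˡ : ∀ x y → x xor y ≡ y → x ≡ false
xor-cancelˡ false _     _  = refl
xor-cancelˡ true  true  ()
xor-cancelˡ true  false ()

even-gap : ∀ {ℓ L} → ℓ ≤ L → odd ℓ ≡ odd L → odd (L ∸ ℓ) ≡ false
even-gap {ℓ} {L} ℓ≤L same = xor-cancelˡ (odd (L ∸ ℓ)) (odd ℓ) (begin
  odd (L ∸ ℓ) xor odd ℓ ≡⟨ odd-+ (L ∸ ℓ) ℓ ⟨
  odd (L ∸ ℓ + ℓ)       ≡⟨ cong odd (m∸n+n≡m ℓ≤L) ⟩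
  odd L                 ≡⟨ same ⟨
  odd ℓ                 ∎)
  where open ≡-Reasoning

-- The largest number ≤ D of parity c, provided some number ≤ D has parity c.
targetLength : ℕ → Bool → ℕ
targetLength D c with odd D Bool.≟ c
... | yes _ = D
... | no  _ = D ∸ 1

targetLength≤ : ∀ D c → targetLength D c ≤ D
targetLength≤ D c with odd D Bool.≟ c
... | yes _ = ≤-refl
... | no  _ = m∸n≤m D 1

targetLength-fits : ∀ {D c ℓ} → ℓ ≤ D → odd ℓ ≡ c →
                    ℓ ≤ targetLength D c × odd (targetLength D c) ≡ c
targetLength-fits {D} {c} ℓ≤D oddℓ with odd D Bool.≟ c
... | yes oddD = ℓ≤D , oddD
targetLength-fits {suc D} {c} ℓ≤D oddℓ | no oddD≢c with m≤n⇒m<n∨m≡n ℓ≤D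
... | inj₁ ℓ<1+D = ≤-pred ℓ<1+D , Bool.not-injective (¬-not oddD≢c)
... | inj₂ refl  = contradiction oddℓ oddD≢c
targetLength-fits {zero} z≤n oddℓ | no oddD≢c = contradiction oddℓ oddD≢c

module Bipartite {N : ℕ} (E : Fin N → Fin N → Set) (side : Fin N → Bool)
                 (bip : IsBipartiteGraph E side) where
  open IsBipartiteGraph bip using (symmetric; crossing)

  Word : ℕ → Set
  Word = Vec (Fin N)

  E-sym : ∀ {a b} → E a b → E b a
  E-sym {a} {b} = symmetric a b

  E-flips : ∀ {a b} → E a b → side b ≡ not (side a)
  E-flips {a} {b} e = ¬-not (λ eq → crossing a b e (sym eq))

  E-irrefl : ∀ {a} → ¬ E a a
  E-irrefl {a} e = crossing a a e refl

  Mono : Bool → ∀ {m} → Word m → Set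
  Mono s = All (λ a → side a ≡ s)

  Mono-tail : ∀ {s m a} {u : Word m} → Mono s (a ∷ u) → Mono (side a) u
  Mono-tail (refl ∷ mu) = mu

  Mono-flip : ∀ {s m} {u w : Word m} → Mono s u → Pointwise E u w → Mono (not s) w
  Mono-flip []          []       = []
  Mono-flip (refl ∷ mu) (e ∷ es) = E-flips e ∷ Mono-flip mu es

  -- Inductive description of the non-loop edges of G_n: keep a common first
  -- letter, or exchange two whole (nonempty) words which are letterwise
  -- adjacent in G, the first one monochromatic.
  data Step : ∀ {m} → Word m → Word m → Set where
    keep : ∀ {m a} {u w : Word m} → Step u w → Step (a ∷ u) (a ∷ w)
    flip : ∀ {m s} {u w : Word (suc m)} → Mono s u → Pointwise E u w → Step u w

  Adj : ∀ {m} → Word m → Word m → Set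
  Adj u w = u ≡ w ⊎ Step u w

  Step-sym : ∀ {m} {u w : Word m} → Step u w → Step w u
  Step-sym (keep s)     = keep (Step-sym s)
  Step-sym (flip mu es) = flip (Mono-flip mu es) (Pointwise.sym E-sym es)

  Adj-sym : ∀ {m} {u w : Word m} → Adj u w → Adj w u
  Adj-sym (inj₁ eq) = inj₁ (sym eq)
  Adj-sym (inj₂ s)  = inj₂ (Step-sym s)

  Step⇒≢ : ∀ {m} {u w : Word m} → Step u w → u ≢ w
  Step⇒≢ (keep s)             refl = Step⇒≢ s refl
  Step⇒≢ (flip _ (e ∷ _))     refl = E-irrefl e

  keepᵂ : ∀ {m k} a {u w : Word m} → Walk Adj u w k → Walk Adj (a ∷ u) (a ∷ w) k
  keepᵂ a = mapᵂ (a ∷_) λ { (inj₁ refl) → inj₁ refl ; (inj₂ s) → inj₂ (keep s) }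

  tailᵂ : ∀ {m k a b} {u w : Word m} → Walk Adj (a ∷ u) (b ∷ w) k → Walk Adj u w k
  tailᵂ here                         = here
  tailᵂ (step {y = _ ∷ _} adj rest) = step (tail-Adj adj) (tailᵂ rest)
    where
      tail-Adj : ∀ {m a b} {u w : Word m} → Adj (a ∷ u) (b ∷ w) → Adj u w
      tail-Adj (inj₁ refl)                         = inj₁ refl
      tail-Adj (inj₂ (keep s))                     = inj₂ s
      tail-Adj {u = []}    {[]}    (inj₂ (flip _ _))          = inj₁ refl
      tail-Adj {u = _ ∷ _} {_ ∷ _} (inj₂ (flip (_ ∷ mu) (_ ∷ es))) = inj₂ (flip mu es)

  allSide⇒Mono : ∀ s {m} (w : Word m) → allSide side s w ≡ true → Mono s w
  allSide⇒Mono s [] _ = []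
  allSide⇒Mono true  (a ∷ w) h with side a in eq
  ... | true  = eq ∷ allSide⇒Mono true w h
  allSide⇒Mono false (a ∷ w) h with side a in eq
  ... | false = eq ∷ allSide⇒Mono false w h

  Mono⇒allSide : ∀ s {m} {w : Word m} → Mono s w → allSide side s w ≡ true
  Mono⇒allSide s     []                = refl
  Mono⇒allSide true  (eq ∷ mw) rewrite eq = Mono⇒allSide true mw
  Mono⇒allSide false (eq ∷ mw) rewrite eq = Mono⇒allSide false mw

  code : Bool → ℕ
  code true  = 1
  code false = 2

  typ⇒Mono : ∀ s {m} (w : Word m) → typ side w ≡ code s → Mono s w
  typ⇒Mono s w h with allSide side true w in inV₁ | allSide side false w in inV₂ | s | h
  ... | true  | _    | true  | _  = allSide⇒Mono true w inV₁
  ... | true  | _    | false | ()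
  ... | false | true | false | _  = allSide⇒Mono false w inV₂
  ... | false | true | true  | ()
  ... | false | false | true  | ()
  ... | false | false | false | ()

  Mono⇒typ : ∀ s {m a} {w : Word m} → Mono s (a ∷ w) → typ side (a ∷ w) ≡ code s
  Mono⇒typ true  (eq ∷ mw) rewrite eq | Mono⇒allSide true mw  = refl
  Mono⇒typ false (eq ∷ mw) rewrite eq | Mono⇒allSide false mw = refl

  PostfixEdge : Σ ℕ (λ m → Word m × Word m) → Set
  PostfixEdge (_ , x̃ , ỹ) = PostfixAdj E side x̃ ỹ

  fromPointwiseE : ∀ {m} {u w : Word m} → PointwiseE E u w → Pointwise E u w
  fromPointwiseE []       = []
  fromPointwiseE (e ∷ es) = e ∷ fromPointwiseE es

  toPointwiseE : ∀ {m} {u w : Word m} → Pointwise E u w → PointwiseE E u w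
  toPointwiseE []       = []
  toPointwiseE (e ∷ es) = e ∷ toPointwiseE es

  opposite⇒types : ∀ s {i j : ℕ} → i ≡ code s → j ≡ code (not s) →
                   (i ≡ 1 × j ≡ 2) ⊎ (i ≡ 2 × j ≡ 1)
  opposite⇒types true  i≡1 j≡2 = inj₁ (i≡1 , j≡2)
  opposite⇒types false i≡2 j≡1 = inj₂ (i≡2 , j≡1)

  postfixEdge⇒Step : ∀ {n} (x y : Word n) → x ≢ y → PostfixEdge (postfixes x y) → Step x y
  postfixEdge⇒Step []      []      x≢y _ = contradiction refl x≢y
  postfixEdge⇒Step (a ∷ x) (b ∷ y) x≢y edge with a ≟ b | edge
  ... | yes refl | tailEdge            =
    keep (postfixEdge⇒Step x y (λ eq → x≢y (cong (a ∷_) eq)) tailEdge)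
  ... | no _     | inj₁ (x̃∈V₁ , _) , es = flip (typ⇒Mono true  _ x̃∈V₁) (fromPointwiseE es)
  ... | no _     | inj₂ (x̃∈V₂ , _) , es = flip (typ⇒Mono false _ x̃∈V₂) (fromPointwiseE es)

  Step⇒postfixEdge : ∀ {n} {x y : Word n} → Step x y → PostfixEdge (postfixes x y)
  Step⇒postfixEdge {x = a ∷ _} (keep s) with a ≟ a
  ... | yes _  = Step⇒postfixEdge s
  ... | no a≢a = contradiction refl a≢a
  Step⇒postfixEdge {x = a ∷ _} {b ∷ _} (flip {s = s} mx es) with a ≟ b
  ... | yes refl = contradiction (Pointwise.head es) E-irrefl
  ... | no _     = opposite⇒types s (Mono⇒typ s mx) (Mono⇒typ (not s) (Mono-flip mx es)) ,
                   toPointwiseE es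

  Gn⇒Adj : ∀ {n} {x y : Word n} → Gn E side n x y → Adj x y
  Gn⇒Adj               (inj₁ eq)           = inj₁ eq
  Gn⇒Adj {x = x} {y} (inj₂ (x≢y , edge)) = inj₂ (postfixEdge⇒Step x y x≢y edge)

  Adj⇒Gn : ∀ {n} {x y : Word n} → Adj x y → Gn E side n x y
  Adj⇒Gn (inj₁ eq) = inj₁ eq
  Adj⇒Gn (inj₂ s)  = inj₂ (Step⇒≢ s , Step⇒postfixEdge s)

  changes-cons≤ : ∀ c b {m} (w : Word m) →
                  changes side c (b ∷ w) ≤ suc (changes side (side b) w)
  changes-cons≤ c b w with sameSide c (side b)
  ... | true  = n≤1+n _
  ... | false = ≤-refl

  changes-same : ∀ {c b m} {w : Word m} → side b ≡ c →
                 changes side c (b ∷ w) ≡ changes side (side b) w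
  changes-same {c} {b} b≡c with side b | c
  ... | true  | true  = refl
  ... | false | false = refl
  ... | true  | false = contradiction b≡c λ ()
  ... | false | true  = contradiction b≡c λ ()

  changes-switch : ∀ {c b m} {w : Word m} → side b ≢ c →
                   changes side c (b ∷ w) ≡ suc (changes side (side b) w)
  changes-switch {c} {b} b≢c with side b | c
  ... | true  | true  = contradiction refl b≢c
  ... | true  | false = refl
  ... | false | true  = refl
  ... | false | false = contradiction refl b≢c

  changes-Mono : ∀ {t m} {v : Word m} → Mono t v → changes side t v ≡ 0
  changes-Mono []          = refl
  changes-Mono {v = _ ∷ v} (eq ∷ mv) =
    trans (changes-same {w = v} eq) (changes-Mono (Mono-tail (eq ∷ mv)))

  blockSum : ∀ {m} → Word m → Word m → ℕ
  blockSum []      []      = 0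
  blockSum (a ∷ x) (b ∷ y) with a ≟ b
  ... | yes _ = blockSum x y
  ... | no  _ = blocks side (a ∷ x) + blocks side (b ∷ y)

  blockSum-postfixes : ∀ {n} (x y : Word n) → blocksˣ side x y + blocksʸ side x y ≡ blockSum x y
  blockSum-postfixes []      []      = refl
  blockSum-postfixes (a ∷ x) (b ∷ y) with a ≟ b
  ... | yes _ = blockSum-postfixes x y
  ... | no  _ = refl

  changes-step : ∀ t {m} {u w : Word m} → Step u w → changes side t u ≤ suc (changes side t w)
  changes-step t {u = e ∷ u} (keep s) =
    ≤-trans (+-monoʳ-≤ _ (changes-step (side e) s)) (≤-reflexive (+-suc _ _))
  changes-step t {u = e ∷ u} (flip mu _) =
    ≤-trans (changes-cons≤ t e u) (s≤s (≤-trans (≤-reflexive (changes-Mono (Mono-tail mu))) z≤n))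

  blockSum-refl : ∀ {m} (x : Word m) → blockSum x x ≡ 0
  blockSum-refl []      = refl
  blockSum-refl (a ∷ x) with a ≟ a
  ... | yes _  = blockSum-refl x
  ... | no a≢a = contradiction refl a≢a

  blockSum-Mono : ∀ t {m} (z y : Word m) → Mono t z →
                  changes side t y ≤ blockSum z y ∸ 1 × blockSum z y ∸ 1 ≤ suc (changes side t y)
  blockSum-Mono t []      []      _         = z≤n , z≤n
  blockSum-Mono t (e ∷ z) (g ∷ y) (eq ∷ mz) with e ≟ g
  ... | yes refl rewrite changes-same {w = y} eq = blockSum-Mono (side e) z y (Mono-tail (eq ∷ mz))
  ... | no  _    rewrite changes-Mono (Mono-tail (eq ∷ mz)) =
    changes-cons≤ t g y , s≤s (m≤n+m _ _)

  blockSum-step : ∀ {m} {x z : Word m} (y : Word m) → Step x z →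
                  blockSum x y ∸ 1 ≤ suc (blockSum z y ∸ 1)
  blockSum-step {x = a ∷ x} (b ∷ y) (keep s) with a ≟ b
  ... | yes refl = blockSum-step y s
  ... | no  _    = +-monoˡ-≤ (suc (changes side (side b) y)) (changes-step (side a) s)
  blockSum-step {x = a ∷ x} {c ∷ z} (b ∷ y) (flip mx es) with a ≟ b | c ≟ b
  ... | yes refl | yes refl = contradiction (Pointwise.head es) E-irrefl
  ... | yes refl | no  _    rewrite changes-Mono (Mono-tail (Mono-flip mx es)) =
    ≤-trans (proj₂ (blockSum-Mono (side a) x y (Mono-tail mx))) (n≤1+n _)
  ... | no  _    | yes refl rewrite changes-Mono (Mono-tail mx) =
    s≤s (proj₁ (blockSum-Mono (side c) z y (Mono-tail (Mono-flip mx es))))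
  ... | no  _    | no  _    rewrite changes-Mono (Mono-tail mx) =
    s≤s (≤-trans (n≤1+n _) (m≤n+m _ _))

  lowerBound : ∀ {m k} {x y : Word m} → Walk Adj x y k → blockSum x y ∸ 1 ≤ k
  lowerBound {x = x} here                       rewrite blockSum-refl x = z≤n
  lowerBound         (step (inj₁ refl) rest) = ≤-trans (lowerBound rest) (n≤1+n _)
  lowerBound {y = y} (step (inj₂ s)    rest) = ≤-trans (blockSum-step y s) (s≤s (lowerBound rest))

  -- Upper bound, part 1: making the postfixes monochromatic.

  HasNbr : Fin N → Set
  HasNbr a = ∃ λ b → E a b

  Linked : ∀ {m} → Word m → Word m → Set
  Linked = Pointwise (Connected E)

  Linked-sym : ∀ {m} {u w : Word m} → Linked u w → Linked w u
  Linked-sym = Pointwise.sym λ (k , v) → k , reverseᵂ E-sym v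

  Linked-trans : ∀ {m} {u v w : Word m} → Linked u v → Linked v w → Linked u w
  Linked-trans = Pointwise.trans λ (k , v) (l , w) → k + l , v ++ᵂ w

  Walk⇒Linked : ∀ {m k} {u w : Word m} → Walk Adj u w k → Linked u w
  Walk⇒Linked here                    = Pointwise.refl (0 , here)
  Walk⇒Linked (step (inj₁ refl) rest) = Walk⇒Linked rest
  Walk⇒Linked (step (inj₂ s) rest)    = Linked-trans (Step⇒Linked s) (Walk⇒Linked rest)
    where
      Step⇒Linked : ∀ {m} {u w : Word m} → Step u w → Linked u w
      Step⇒Linked (keep s)    = (0 , here) ∷ Step⇒Linked s
      Step⇒Linked (flip _ es) = Pointwise.map (λ e → 1 , step e here) es

  HasNbr-Linked : ∀ {m} {u w : Word m} → Linked u w → All HasNbr u → All HasNbr w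
  HasNbr-Linked []                  []       = []
  HasNbr-Linked {u = a ∷ _} ((_ , v) ∷ linked) (h ∷ hs) =
    along (reverseᵂ E-sym v) ∷ HasNbr-Linked linked hs
    where
      along : ∀ {b k} → Walk E b a k → HasNbr b
      along here       = h
      along (step e _) = _ , e

  Pointwise⇒HasNbr : ∀ {m} {u w : Word m} → Pointwise E u w → All HasNbr u
  Pointwise⇒HasNbr []       = []
  Pointwise⇒HasNbr (e ∷ es) = (_ , e) ∷ Pointwise⇒HasNbr es

  -- If the first letter changes along a walk in G_n, it is flipped at some
  -- step, together with the whole word behind it; hence every letter of the
  -- starting word has a neighbour in G.
  differing⇒HasNbr : ∀ {m k a b} {u y : Word m} →
                     Walk Adj (a ∷ u) (b ∷ y) k → a ≢ b → All HasNbr (a ∷ u)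
  differing⇒HasNbr here                           a≢b = contradiction refl a≢b
  differing⇒HasNbr (step (inj₁ refl) rest)        a≢b = differing⇒HasNbr rest a≢b
  differing⇒HasNbr (step (inj₂ (keep s)) rest)    a≢b with differing⇒HasNbr rest a≢b
  ... | h ∷ hs = h ∷ back s hs
    where
      back : ∀ {m} {u w : Word m} → Step u w → All HasNbr w → All HasNbr u
      back (keep s)    (h ∷ hs) = h ∷ back s hs
      back (flip _ es) _        = Pointwise⇒HasNbr es
  differing⇒HasNbr (step (inj₂ (flip _ es)) rest) _   = Pointwise⇒HasNbr es

  neighbours : ∀ {m} {v : Word m} → All HasNbr v → Σ (Word m) λ w → Pointwise E v w
  neighbours []             = [] , []
  neighbours ((b , e) ∷ hs) with neighbours hs
  ... | w , es = b ∷ w , e ∷ es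

  -- Flipping the blocks of a·u from the back makes u monochromatic of the
  -- side of a, using one step per block boundary of a·u.
  monochromatize : ∀ a {m} (u : Word m) → All HasNbr u →
                   Σ (Word m) λ U → Mono (side a) U ×
                   ∃ λ c → c ≤ changes side (side a) u × Walk Adj (a ∷ u) (a ∷ U) c
  monochromatize a []      []               = [] , [] , 0 , z≤n , here
  monochromatize a (h ∷ u) nbrs@(_ ∷ nbrsᵤ) with monochromatize h u nbrsᵤ
  ... | U , mU , c , c≤ , toU with side h Bool.≟ side a
  ...   | yes same = h ∷ U , same ∷ subst (λ s → Mono s U) same mU , c ,
                     subst (c ≤_) (sym (changes-same {w = u} same)) c≤ , keepᵂ a toU
  ...   | no differ with neighbours (HasNbr-Linked (Walk⇒Linked toU) nbrs)
  ...     | Z , es = Z , subst (λ s → Mono s Z) (sym (¬-not (differ ∘ sym)))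
                                   (Mono-flip (refl ∷ mU) es) ,
                     suc c , subst (suc c ≤_) (sym (changes-switch {w = u} differ)) (s≤s c≤) ,
                     keepᵂ a toU ∷ʳᵂ inj₂ (keep (flip (refl ∷ mU) es))

  -- Upper bound, part 2: joining two monochromatic words.

  walk-parity : ∀ {u v ℓ} → Walk E u v ℓ → odd ℓ ≡ side u xor side v
  walk-parity {u} here = sym (Bool.xor-same (side u))
  walk-parity {u} {v} (step {y = w} {k = ℓ} e rest) = begin
    not (odd ℓ)              ≡⟨ cong not (walk-parity rest) ⟩
    not (side w xor side v)  ≡⟨ not-distribˡ-xor (side w) (side v) ⟩
    not (side w) xor side v  ≡⟨ cong (λ s → not s xor side v) (E-flips e) ⟩
    not (not (side u)) xor side v ≡⟨ cong (_xor side v) (Bool.not-involutive (side u)) ⟩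
    side u xor side v        ∎
    where open ≡-Reasoning

  -- Walking back and forth along an edge lengthens a walk by any even number.
  padEven : ∀ j {u v ℓ} → odd j ≡ false → Walk E u v ℓ → HasNbr v → Walk E u v (j + ℓ)
  padEven zero          _    w _       = w
  padEven (suc (suc j)) even w (b , e) =
    padEven j (trans (sym (Bool.not-involutive (odd j))) even) w (b , e) ∷ʳᵂ e ∷ʳᵂ E-sym e

  padTo : ∀ {u v ℓ L} → ℓ ≤ L → odd ℓ ≡ odd L → Walk E u v ℓ → HasNbr v → Walk E u v L
  padTo {u} {v} ℓ≤L same w h =
    subst (Walk E u v) (m∸n+n≡m ℓ≤L) (padEven _ (even-gap ℓ≤L same) w h)

  -- Letterwise G-walks of a common length out of a nonempty monochromatic
  -- word are traversed simultaneously: each step flips the whole word.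
  simultaneousᵂ : ∀ {m s} L {X Y : Word (suc m)} → Mono s X →
                  Pointwise (λ u v → Walk E u v L) X Y → Walk Adj X Y L
  simultaneousᵂ zero    mX walks with Pointwise.Pointwise-≡⇒≡ (Pointwise.map (λ { here → refl }) walks)
  ... | refl = here
  simultaneousᵂ (suc L) mX walks with firstEdges walks
    where
      firstEdges : ∀ {m} {X Y : Word m} → Pointwise (λ u v → Walk E u v (suc L)) X Y →
                   Σ (Word m) λ Z → Pointwise E X Z × Pointwise (λ u v → Walk E u v L) Z Y
      firstEdges []                  = [] , [] , []
      firstEdges (step e w ∷ walks) with firstEdges walks
      ... | Z , es , rests = _ ∷ Z , e ∷ es , w ∷ rests
  ... | Z , es , rests = step (inj₂ (flip mX es)) (simultaneousᵂ L (Mono-flip mX es) rests)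

  module _ (D : ℕ) (diam : IsDiam E D) where

    Short : Fin N → Fin N → Set
    Short u v = ∃ λ ℓ → ℓ ≤ D × Walk E u v ℓ

    -- Connected vertices are (not not) joined by a walk of length ≤ Diam(G):
    -- a shortest walk realises the distance, which is at most the diameter.
    shortWalk : ∀ {u v} → Connected E u v → ¬ ¬ Short u v
    shortWalk {u} {v} (_ , w) = ¬¬-map
      (λ (ℓ , shortest , minimal) → ℓ , proj₁ diam u v ℓ (shortest , minimal) , shortest)
      (¬¬-least {P = Walk E u v} w)

    shortWalks : ∀ {m} {X Y : Word m} → Linked X Y → ¬ ¬ Pointwise Short X Y
    shortWalks []                 noWalks = noWalks []
    shortWalks (conn ∷ connected) noWalks =
      shortWalk conn λ sw → shortWalks connected λ sws → noWalks (sw ∷ sws)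

    -- Short walks between words of sides s and t all have parity s xor t,
    -- so they can be padded to the common length targetLength D (s xor t).
    padAll : ∀ {s t m} {X Y : Word m} → Mono s X → Mono t Y → All HasNbr Y →
             Pointwise Short X Y → Pointwise (λ u v → Walk E u v (targetLength D (s xor t))) X Y
    padAll []          []          []       []                    = []
    padAll {s} {t} (su ∷ mX) (sv ∷ mY) (h ∷ hs) ((ℓ , ℓ≤D , w) ∷ shorts) =
      padTo (proj₁ fits) (trans parity (sym (proj₂ fits))) w h ∷ padAll mX mY hs shorts
      where
        parity : odd ℓ ≡ s xor t
        parity = trans (walk-parity w) (cong₂ _xor_ su sv)
        fits : ℓ ≤ targetLength D (s xor t) × odd (targetLength D (s xor t)) ≡ s xor t
        fits = targetLength-fits ℓ≤D parity

    bridge : ∀ {s t m} {X Y : Word (suc m)} → Mono s X → Mono t Y → All HasNbr Y →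
             Linked X Y → ¬ ¬ Walk Adj X Y (targetLength D (s xor t))
    bridge mX mY nbrs linked =
      ¬¬-map (λ shorts → simultaneousᵂ _ mX (padAll mX mY nbrs shorts)) (shortWalks linked)

    -- Upper bound for postfixes a·x, b·y with a ≠ b: monochromatize both,
    -- then bridge the two monochromatic words.
    upperPostfix : ∀ {m k a b} (x y : Word m) → a ≢ b → Walk Adj (a ∷ x) (b ∷ y) k →
                   ¬ ¬ (∃ λ K → K ≤ blocks side (a ∷ x) + blocks side (b ∷ y) + D ∸ 2 ×
                                Walk Adj (a ∷ x) (b ∷ y) K)
    upperPostfix {a = a} {b} x y a≢b walk
      with differing⇒HasNbr walk a≢b | differing⇒HasNbr (reverseᵂ Adj-sym walk) (a≢b ∘ sym)
    ... | _ ∷ nbrsˣ | nbrsʸ@(_ ∷ nbrsʸ-tail)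
      with monochromatize a x nbrsˣ | monochromatize b y nbrsʸ-tail
    ... | X , mX , cˣ , cˣ≤ , toX | Y , mY , cʸ , cʸ≤ , toY =
      ¬¬-map (λ middle → _ , bound , toX ++ᵂ middle ++ᵂ reverseᵂ Adj-sym toY)
             (bridge (refl ∷ mX) (refl ∷ mY) (HasNbr-Linked (Walk⇒Linked toY) nbrsʸ) linked)
      where
        linked : Linked (a ∷ X) (b ∷ Y)
        linked = Linked-trans (Linked-sym (Walk⇒Linked toX))
                              (Linked-trans (Walk⇒Linked walk) (Walk⇒Linked toY))
        -- r - 1 flips for x, at most D for the bridge, q - 1 flips for y.
        bound : cˣ + (targetLength D (side a xor side b) + cʸ) ≤
                blocks side (a ∷ x) + blocks side (b ∷ y) + D ∸ 2
        bound = ≤-trans (+-mono-≤ cˣ≤ (+-mono-≤ (targetLength≤ D _) cʸ≤))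
                        (≤-reflexive (rearrange (changes side (side a) x) (changes side (side b) y)))
          where
            rearrange : ∀ p q → p + (D + q) ≡ suc p + suc q + D ∸ 2
            rearrange p q rewrite +-suc p q | +-comm D q | +-assoc p q D = refl

    upperBound : ∀ {m k} (x y : Word m) → Walk Adj x y k →
                 ¬ ¬ (∃ λ K → K ≤ blockSum x y + D ∸ 2 × Walk Adj x y K)
    upperBound []      []      _    = λ noWalk → noWalk (0 , z≤n , here)
    upperBound (a ∷ x) (b ∷ y) walk with a ≟ b
    ... | yes refl = ¬¬-map (λ (K , K≤ , w) → K , K≤ , keepᵂ a w) (upperBound x y (tailᵂ walk))
    ... | no  a≢b  = upperPostfix x y a≢b walk

-- Theorem: for x ≠ y in one component of G_n with postfixes of r and q blocks,
-- r + q - 1 ≤ dist(x, y) ≤ r + q + Diam(G) - 2.  (The argument does not need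
-- x ≠ y: for x = y both postfixes are empty and the bounds hold trivially.)
mainTheorem7 : (N : ℕ) (E : Fin N → Fin N → Set) (side : Fin N → Bool) →
    IsBipartiteGraph E side →
    (D : ℕ) → IsDiam E D →
    (n : ℕ) (x y : Vec (Fin N) n) → x ≢ y → Connected (Gn E side n) x y →
    (d : ℕ) → IsDist (Gn E side n) x y d →
    (blocksˣ side x y + blocksʸ side x y ∸ 1 ≤ d)
      × (d ≤ blocksˣ side x y + blocksʸ side x y + D ∸ 2)
mainTheorem7 N E side bip D diam n x y _ (_ , walk) d (shortest , minimal)
  rewrite Bipartite.blockSum-postfixes E side bip x y =
    lowerBound (toAdj shortest) ,
    decidable-stable (d ≤? _) (¬¬-map (λ (K , K≤ , w) → ≤-trans (minimal K (fromAdj w)) K≤)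
                                      (upperBound D diam x y (toAdj walk)))
  where
    open Bipartite E side bip
    toAdj : ∀ {u v k} → Walk (Gn E side n) u v k → Walk Adj u v k
    toAdj = mapᵂ id Gn⇒Adj
    fromAdj : ∀ {u v k} → Walk Adj u v k → Walk (Gn E side n) u v k
    fromAdj = mapᵂ id Adj⇒Gn
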